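{- Let $\ell\ge1$, $B=(b_1,\dots,b_\ell)$ with integers $b_i\ge2$, $u\in\Sigma_B$, $v\in\Delta_B$, and let $P=\{i:v_i\ne g,\ v_i=u_i\}$, $Q=\{i:v_i\ne g,\ v_i\ne u_i\}$. (i) For each $i$ with $v_i\ne g$, let $\phi_i(u,v)=\sum_{j=\max\{1,v_i\}}^{b_i-1}\frac{\nu_i(v_i,j)\nu_i(u_i,j)}{j(j+1)}$. Then $\phi_i(u,v)=\frac{b_i-1}{b_i}$ if $i\in P$, and $\phi_i(u,v)=-\frac1{b_i}$ if $i\in Q$. (ii) For every $G$ with $G_v\subseteq G\subseteq\{1,\dots,\ell\}$, writing $\overline G=\{1,\dots,\ell\}\setminus G$, $$\sum_{v'\in\Gamma_B,\ G_{v'}=G}\frac{\nu_B(v,v')\nu_B(u,v')}{\prod_{i\in\overline G_{v'}}(v'_i+{v'_i}^2)}=\frac{(-1)^{|Q\setminus G|+|G_v|}\prod_{i\in G_v}b_i\prod_{i\in P\setminus G}(b_i-1)}{\prod_{i\in\overline G}b_i}.$$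
   Context: For an integer $b\ge2$ let $\Sigma_b=\{0,\dots,b-1\}$, $\Delta_b=\Sigma_b\cup\{g\}$ ($g$ a gap symbol), $\Gamma_b=\Delta_b\setminus\{0\}$; $\Sigma_B=\prod_i\Sigma_{b_i}$, $\Delta_B=\prod_i\Delta_{b_i}$, $\Gamma_B=\prod_i\Gamma_{b_i}$, elements written as words. For $v\in\Delta_B$, $G_v=\{i:v_i=g\}$, $\overline G_v=\{1,\dots,\ell\}\setminus G_v$. On $\Delta_{b_i}$ use the order $0\prec1\prec\cdots\prec b_i-1\prec g$ and define $\nu_i(x,y)=-b_i$ if $x=y=g$; $-y$ if $x=y\ne g$; $1$ if $x\prec y$; $0$ if $x\succ y$. $\nu_B(x,y)=\prod_{i=1}^\ell\nu_i(x_i,y_i)$. -}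

module Defs where

open import Data.Nat as ℕ using (ℕ; zero; suc; _≤ᵇ_; _<ᵇ_; _≡ᵇ_)
open import Data.Integer as ℤ using (ℤ; +_)
open import Data.Rational as ℚ using (ℚ; 0ℚ; 1ℚ; _/_)
open import Data.Fin as Fin using (Fin; toℕ)
open import Data.Fin.Subset using (Subset; ∁)
import Data.Vec
open import Data.Bool using (Bool; true; false; if_then_else_; _∧_; not)
open import Data.Vec using (tabulate; lookup)
open import Data.Vec.Properties using (≡-dec)
open import Data.Bool.Properties using () renaming (_≟_ to _≟B_)
open import Data.List as List using (List; []; _∷_)
open import Relation.Nullary.Decidable using (⌊_⌋)

ℕ→ℚ : ℕ → ℚ
ℕ→ℚ n = + n / 1

-- reciprocal of a natural number (only used at nonzero arguments; 1/0 := 0)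
inv : ℕ → ℚ
inv zero    = 0ℚ
inv (suc n) = + 1 / suc n

negOnePow : ℕ → ℚ
negOnePow zero    = 1ℚ
negOnePow (suc n) = ℚ.- negOnePow n

∑ : (n : ℕ) → (Fin n → ℚ) → ℚ
∑ zero    f = 0ℚ
∑ (suc n) f = f Fin.zero ℚ.+ ∑ n (λ i → f (Fin.suc i))

∏ : (n : ℕ) → (Fin n → ℚ) → ℚ
∏ zero    f = 1ℚ
∏ (suc n) f = f Fin.zero ℚ.* ∏ n (λ i → f (Fin.suc i))

∏∈ : {n : ℕ} → Subset n → (Fin n → ℚ) → ℚ
∏∈ {n} S f = ∏ n (λ i → if lookup S i then f i else 1ℚ)

sumList : {A : Set} → (A → ℚ) → List A → ℚ
sumList f []       = 0ℚ
sumList f (x ∷ xs) = f x ℚ.+ sumList f xs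

-- Δ_b = Σ_b ∪ {g}

data Δ (b : ℕ) : Set where
  dig : Fin b → Δ b
  gap : Δ b

_≺ᵇ_ : {b : ℕ} → Δ b → Δ b → Bool
dig x ≺ᵇ dig y = toℕ x <ᵇ toℕ y
dig x ≺ᵇ gap   = true
gap   ≺ᵇ _     = false

ν : (b : ℕ) → Δ b → Δ b → ℚ
ν b gap     gap     = ℚ.- ℕ→ℚ b
ν b (dig x) (dig y) =
  if toℕ x ≡ᵇ toℕ y then ℚ.- ℕ→ℚ (toℕ y)
  else (if dig x ≺ᵇ dig y then 1ℚ else 0ℚ)
ν b x y = if x ≺ᵇ y then 1ℚ else 0ℚ

ΣB : {ℓ : ℕ} → (Fin ℓ → ℕ) → Set
ΣB {ℓ} B = (i : Fin ℓ) → Fin (B i)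

ΔB : {ℓ : ℕ} → (Fin ℓ → ℕ) → Set
ΔB {ℓ} B = (i : Fin ℓ) → Δ (B i)

emb : {ℓ : ℕ} {B : Fin ℓ → ℕ} → ΣB B → ΔB B
emb u i = dig (u i)

νB : {ℓ : ℕ} (B : Fin ℓ → ℕ) → ΔB B → ΔB B → ℚ
νB {ℓ} B x y = ∏ ℓ (λ i → ν (B i) (x i) (y i))

isGap : {b : ℕ} → Δ b → Bool
isGap gap     = true
isGap (dig _) = false

Gset : {ℓ : ℕ} {B : Fin ℓ → ℕ} → ΔB B → Subset ℓ
Gset v = tabulate (λ i → isGap (v i))

sameDig : {b : ℕ} → Fin b → Δ b → Bool
sameDig d gap     = false
sameDig d (dig e) = toℕ d ≡ᵇ toℕ e

Pset : {ℓ : ℕ} {B : Fin ℓ → ℕ} → ΣB B → ΔB B → Subset ℓ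
Pset u v = tabulate (λ i → not (isGap (v i)) ∧ sameDig (u i) (v i))

Qset : {ℓ : ℕ} {B : Fin ℓ → ℕ} → ΣB B → ΔB B → Subset ℓ
Qset u v = tabulate (λ i → not (isGap (v i)) ∧ not (sameDig (u i) (v i)))

-- φ_i(u,v) = Σ_{j = max{1,v_i}}^{b_i - 1} ν_i(v_i,j) ν_i(u_i,j) / (j(j+1))
-- (defined for v_i ≠ g; the value at v_i = g is an unused dummy 0)
φ : {ℓ : ℕ} (B : Fin ℓ → ℕ) → ΣB B → ΔB B → Fin ℓ → ℚ
φ B u v i with v i
... | gap   = 0ℚ
... | dig d = ∑ (B i) (λ j →
        if (1 ≤ᵇ toℕ j) ∧ (toℕ d ≤ᵇ toℕ j)
        then ν (B i) (dig d) (dig j) ℚ.* ν (B i) (dig (u i)) (dig j)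
               ℚ.* inv (toℕ j ℕ.* suc (toℕ j))
        else 0ℚ)

-- enumeration of Γ_B = ∏ (Δ_{b_i} ∖ {0})

Γlist : (b : ℕ) → List (Δ b)
Γlist b = gap ∷ List.map dig (List.filterᵇ (λ j → 1 ≤ᵇ toℕ j) (List.allFin b))

allWords : (ℓ : ℕ) (B : Fin ℓ → ℕ) → ((i : Fin ℓ) → List (Δ (B i))) → List (ΔB B)
allWords zero    B L = (λ ()) ∷ []
allWords (suc ℓ) B L =
  List.concatMap (λ x → List.map (λ w → cons x w)
                    (allWords ℓ (λ i → B (Fin.suc i)) (λ i → L (Fin.suc i))))
                 (L Fin.zero)
  where
  cons : Δ (B Fin.zero) → ((i : Fin ℓ) → Δ (B (Fin.suc i))) → ΔB B
  cons x w Fin.zero    = x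
  cons x w (Fin.suc i) = w i

ΓB : {ℓ : ℕ} (B : Fin ℓ → ℕ) → List (ΔB B)
ΓB {ℓ} B = allWords ℓ B (λ i → Γlist (B i))

sumΓ : {ℓ : ℕ} (B : Fin ℓ → ℕ) → Subset ℓ → (ΔB B → ℚ) → ℚ
sumΓ B G f = sumList (λ w → if ⌊ ≡-dec _≟B_ (Gset w) G ⌋ then f w else 0ℚ) (ΓB B)

∏ℕ∈ : {n : ℕ} → Subset n → (Fin n → ℕ) → ℕ
∏ℕ∈ {zero}  S f = 1
∏ℕ∈ {suc n} S f = (if lookup S Fin.zero then f Fin.zero else 1) ℕ.* ∏ℕ∈ (Data.Vec.tail S) (λ i → f (Fin.suc i))

digVal : {b : ℕ} → Δ b → ℕ
digVal gap     = 0
digVal (dig d) = toℕ d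

denom : {ℓ : ℕ} {B : Fin ℓ → ℕ} → ΔB B → ℕ
denom w = ∏ℕ∈ (∁ (Gset w)) (λ i → digVal (w i) ℕ.+ digVal (w i) ℕ.* digVal (w i))

module Submission where

-- (i) Write m = max{u_i, v_i}. Below m the summand of φ_i vanishes, above m it is
-- 1/(j(j+1)) = 1/j - 1/(j+1), and at j = m it is m²/(m(m+1)) = 1 - 1/(m+1) if u_i = v_i = m
-- and -m/(m(m+1)) = -1/(m+1) otherwise (for m ≥ 1); so the sum telescopes to 1 - 1/b_i, resp. -1/b_i.
-- (ii) The constraint G_{v'} = G, ν_B and the denominator all factor over coordinates, so
-- the sum over Γ_B is the product of one-coordinate sums. A coordinate in G only admits
-- v'_i = g and contributes ν_i(v_i, g), i.e. -b_i or 1; a coordinate outside G contributes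
-- exactly φ_i(u, v) from (i).

open import Defs
open import Data.Nat using (ℕ; _≤_; _∸_)
open import Data.Fin using (Fin)
open import Data.Fin.Subset using (Subset; _∈_; _⊆_; ∁; _─_; ∣_∣)
open import Data.Rational using (ℚ; _+_; _*_; -_; _/_; 1ℚ)
open import Data.Integer using (+_)
open import Data.Product using (_×_)
open import Relation.Binary.PropositionalEquality using (_≡_)

open import Level using (0ℓ)
open import Data.Bool using (Bool; true; false; if_then_else_; T; not; _∧_)
open import Data.Bool.Properties using (not-injective) renaming (_≟_ to _≟B_)
open import Data.Empty using (⊥-elim)
open import Data.Fin as Fin using (toℕ)
import Data.Fin.Properties as FinP
open import Data.Integer as ℤ using (ℤ)
import Data.Integer.Properties as ℤP
import Data.Integer.Tactic.RingSolver as ℤ-Solver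
open import Data.List as List using (List; []; _∷_; _++_)
open import Data.Nat as ℕ using (zero; suc; _<_; _≤ᵇ_; _<ᵇ_; _≡ᵇ_; s≤s; z≤n)
import Data.Nat.Properties as ℕP
open import Data.Product using (_,_)
open import Data.Rational as ℚ using (0ℚ; _-_; toℚᵘ)
import Data.Rational.Properties as ℚP
open import Data.Rational.Unnormalised as ℚᵘ using (mkℚᵘ; *≡*) renaming (_≃_ to _≃ᵘ_)
import Data.Rational.Unnormalised.Properties as ℚᵘP
open import Data.Sum using (inj₁; inj₂)
open import Data.Vec as Vec using (Vec; _∷_; []; lookup; tabulate)
open import Data.Vec.Properties using (lookup∘tabulate; []=⇒lookup; lookup⇒[]=; lookup-map; ≡-dec)
open import Relation.Binary.Definitions using (tri<; tri≈; tri>)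
open import Relation.Binary.PropositionalEquality using (refl; sym; trans; cong; cong₂; subst; module ≡-Reasoning)
open import Relation.Nullary.Decidable using (⌊_⌋; yes; no; dec⇒maybe)
open import Tactic.RingSolver using (solve-∀)
import Tactic.RingSolver.Core.AlmostCommutativeRing as ACR

ℚ-ring : ACR.AlmostCommutativeRing 0ℓ 0ℓ
ℚ-ring = ACR.fromCommutativeRing ℚP.+-*-commutativeRing (λ x → dec⇒maybe (0ℚ ℚP.≟ x))

toℚᵘ-ℕ→ℚ : ∀ n → toℚᵘ (ℕ→ℚ n) ≃ᵘ mkℚᵘ (+ n) 0
toℚᵘ-ℕ→ℚ n = ℚP.toℚᵘ-fromℚᵘ (mkℚᵘ (+ n) 0)

toℚᵘ-inv : ∀ n → toℚᵘ (inv (suc n)) ≃ᵘ mkℚᵘ (+ 1) n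
toℚᵘ-inv n = ℚP.toℚᵘ-fromℚᵘ (mkℚᵘ (+ 1) n)

module _ where
  open ℚᵘP.≃-Reasoning

  ℕ→ℚ-+ : ∀ m n → ℕ→ℚ (m ℕ.+ n) ≡ ℕ→ℚ m + ℕ→ℚ n
  ℕ→ℚ-+ m n = ℚP.toℚᵘ-injective (begin
    toℚᵘ (ℕ→ℚ (m ℕ.+ n))            ≈⟨ toℚᵘ-ℕ→ℚ (m ℕ.+ n) ⟩
    mkℚᵘ (+ (m ℕ.+ n)) 0             ≈⟨ *≡* (trans (cong (ℤ._* + 1) (ℤP.pos-+ m n)) (sum-cross (+ m) (+ n))) ⟩
    mkℚᵘ (+ m) 0 ℚᵘ.+ mkℚᵘ (+ n) 0   ≈⟨ ℚᵘP.+-cong (toℚᵘ-ℕ→ℚ m) (toℚᵘ-ℕ→ℚ n) ⟨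
    toℚᵘ (ℕ→ℚ m) ℚᵘ.+ toℚᵘ (ℕ→ℚ n)  ≈⟨ ℚP.toℚᵘ-homo-+ (ℕ→ℚ m) (ℕ→ℚ n) ⟨
    toℚᵘ (ℕ→ℚ m + ℕ→ℚ n)            ∎)
    where
    sum-cross : ∀ (a b : ℤ) → (a ℤ.+ b) ℤ.* + 1 ≡ (a ℤ.* + 1 ℤ.+ b ℤ.* + 1) ℤ.* + 1
    sum-cross = ℤ-Solver.solve-∀

  ℕ→ℚ-* : ∀ m n → ℕ→ℚ (m ℕ.* n) ≡ ℕ→ℚ m * ℕ→ℚ n
  ℕ→ℚ-* m n = ℚP.toℚᵘ-injective (begin
    toℚᵘ (ℕ→ℚ (m ℕ.* n))            ≈⟨ toℚᵘ-ℕ→ℚ (m ℕ.* n) ⟩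
    mkℚᵘ (+ (m ℕ.* n)) 0             ≈⟨ *≡* (cong (ℤ._* + 1) (ℤP.pos-* m n)) ⟩
    mkℚᵘ (+ m) 0 ℚᵘ.* mkℚᵘ (+ n) 0   ≈⟨ ℚᵘP.*-cong (toℚᵘ-ℕ→ℚ m) (toℚᵘ-ℕ→ℚ n) ⟨
    toℚᵘ (ℕ→ℚ m) ℚᵘ.* toℚᵘ (ℕ→ℚ n)  ≈⟨ ℚP.toℚᵘ-homo-* (ℕ→ℚ m) (ℕ→ℚ n) ⟨
    toℚᵘ (ℕ→ℚ m * ℕ→ℚ n)            ∎)

  ℕ→ℚ*inv : ∀ n → ℕ→ℚ (suc n) * inv (suc n) ≡ 1ℚ
  ℕ→ℚ*inv n = ℚP.toℚᵘ-injective (begin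
    toℚᵘ (ℕ→ℚ (suc n) * inv (suc n))         ≈⟨ ℚP.toℚᵘ-homo-* (ℕ→ℚ (suc n)) (inv (suc n)) ⟩
    toℚᵘ (ℕ→ℚ (suc n)) ℚᵘ.* toℚᵘ (inv (suc n)) ≈⟨ ℚᵘP.*-cong (toℚᵘ-ℕ→ℚ (suc n)) (toℚᵘ-inv n) ⟩
    mkℚᵘ (+ suc n) 0 ℚᵘ.* mkℚᵘ (+ 1) n       ≈⟨ *≡* (trans (ℤP.*-identityʳ _) (trans (ℤP.*-identityʳ _)
                                                   (sym (trans (ℤP.*-identityˡ _) (cong (λ k → + suc k) (ℕP.+-identityʳ n)))))) ⟩
    ℚᵘ.1ℚᵘ                                    ∎)

  inv-* : ∀ m n → inv (m ℕ.* n) ≡ inv m * inv n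
  inv-* zero    n       = sym (ℚP.*-zeroˡ (inv n))
  inv-* (suc m) zero    = trans (cong inv (ℕP.*-zeroʳ m)) (sym (ℚP.*-zeroʳ (inv (suc m))))
  inv-* (suc m) (suc n) = ℚP.toℚᵘ-injective (begin
    toℚᵘ (inv (suc m ℕ.* suc n))                ≈⟨ toℚᵘ-inv (n ℕ.+ m ℕ.* suc n) ⟩
    mkℚᵘ (+ 1) (n ℕ.+ m ℕ.* suc n)              ≈⟨ *≡* (trans (ℤP.*-identityˡ (+ suc (n ℕ.+ m ℕ.* suc n))) (sym (ℤP.*-identityˡ _))) ⟩
    mkℚᵘ (+ 1) m ℚᵘ.* mkℚᵘ (+ 1) n              ≈⟨ ℚᵘP.*-cong (toℚᵘ-inv m) (toℚᵘ-inv n) ⟨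
    toℚᵘ (inv (suc m)) ℚᵘ.* toℚᵘ (inv (suc n))  ≈⟨ ℚP.toℚᵘ-homo-* (inv (suc m)) (inv (suc n)) ⟨
    toℚᵘ (inv (suc m) * inv (suc n))            ∎)

ℕ→ℚ-suc : ∀ n → ℕ→ℚ (suc n) ≡ 1ℚ + ℕ→ℚ n
ℕ→ℚ-suc = ℕ→ℚ-+ 1

1+ℕ→ℚ*inv : ∀ n → (1ℚ + ℕ→ℚ n) * inv (suc n) ≡ 1ℚ
1+ℕ→ℚ*inv n = trans (cong (_* inv (suc n)) (sym (ℕ→ℚ-suc n))) (ℕ→ℚ*inv n)

1-inv-suc : ∀ n → 1ℚ - inv (suc n) ≡ ℕ→ℚ n * inv (suc n)
1-inv-suc n = begin
  1ℚ - a                   ≡⟨ cong (_- a) (1+ℕ→ℚ*inv n) ⟨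
  (1ℚ + ℕ→ℚ n) * a - a     ≡⟨ cancel (ℕ→ℚ n) a ⟩
  ℕ→ℚ n * a                ∎
  where
  open ≡-Reasoning
  a = inv (suc n)
  cancel : ∀ N a → (1ℚ + N) * a - a ≡ N * a
  cancel = solve-∀ ℚ-ring

inv-telescope : ∀ n → inv (suc n ℕ.* suc (suc n)) ≡ inv (suc n) - inv (suc (suc n))
inv-telescope n = begin
  inv (suc n ℕ.* suc (suc n))                          ≡⟨ inv-* (suc n) (suc (suc n)) ⟩
  a * c                                                ≡⟨ expand a c N ⟩
  a * ((1ℚ + N) * c) - c * (N * a)                     ≡⟨ cong₂ (λ x y → a * x - c * y) (1+ℕ→ℚ*inv (suc n)) (ℕ→ℚ*inv n) ⟩
  a * 1ℚ - c * 1ℚ                                      ≡⟨ cong₂ _-_ (ℚP.*-identityʳ a) (ℚP.*-identityʳ c) ⟩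
  a - c                                                ∎
  where
  open ≡-Reasoning
  a = inv (suc n)
  c = inv (suc (suc n))
  N = ℕ→ℚ (suc n)
  expand : ∀ a c N → a * c ≡ a * ((1ℚ + N) * c) - c * (N * a)
  expand = solve-∀ ℚ-ring

νℕ : ℕ → ℕ → ℚ
νℕ x y = if x ≡ᵇ y then - ℕ→ℚ y else (if x <ᵇ y then 1ℚ else 0ℚ)

νℕ-refl : ∀ x → νℕ x x ≡ - ℕ→ℚ x
νℕ-refl x with x ≡ᵇ x in eq
... | true  = refl
... | false = ⊥-elim (subst T eq (ℕP.≡⇒≡ᵇ x x refl))

νℕ-< : ∀ {x y} → x < y → νℕ x y ≡ 1ℚ
νℕ-< {x} {y} x<y with x ≡ᵇ y in eq₁ | x <ᵇ y in eq₂
... | true  | _     = ⊥-elim (ℕP.<-irrefl (ℕP.≡ᵇ⇒≡ x y (subst T (sym eq₁) _)) x<y)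
... | false | true  = refl
... | false | false = ⊥-elim (subst T eq₂ (ℕP.<⇒<ᵇ x<y))

νℕ-> : ∀ {x y} → y < x → νℕ x y ≡ 0ℚ
νℕ-> {x} {y} y<x with x ≡ᵇ y in eq₁ | x <ᵇ y in eq₂
... | true  | _     = ⊥-elim (ℕP.<-irrefl (sym (ℕP.≡ᵇ⇒≡ x y (subst T (sym eq₁) _))) y<x)
... | false | true  = ⊥-elim (ℕP.<-asym y<x (ℕP.<ᵇ⇒< x y (subst T (sym eq₂) _)))
... | false | false = refl

φterm : ℕ → ℕ → ℕ → ℚ
φterm d e j = if 1 ≤ᵇ j then νℕ d j * νℕ e j * inv (j ℕ.* suc j) else 0ℚ

φterm-comm : ∀ d e j → φterm d e j ≡ φterm e d j
φterm-comm d e j = cong (λ x → if 1 ≤ᵇ j then x * inv (j ℕ.* suc j) else 0ℚ) (ℚP.*-comm (νℕ d j) (νℕ e j))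

φterm-below : ∀ {d} e {j} → j < d → φterm d e j ≡ 0ℚ
φterm-below e {zero}  j<d = refl
φterm-below e {suc j} j<d rewrite νℕ-> j<d =
  trans (cong (_* inv (suc j ℕ.* suc (suc j))) (ℚP.*-zeroˡ (νℕ e (suc j)))) (ℚP.*-zeroˡ (inv (suc j ℕ.* suc (suc j))))

φterm-above : ∀ {d e j} → d < j → e < j → φterm d e j ≡ inv j - inv (suc j)
φterm-above {j = suc j} d<j e<j rewrite νℕ-< d<j | νℕ-< e<j =
  trans (ℚP.*-identityˡ (inv (suc j ℕ.* suc (suc j)))) (inv-telescope j)

module _ (k : ℕ) where
  private
    N = ℕ→ℚ (suc k)
    a = inv (suc k)
    c = inv (suc (suc k))

  φterm-diagonal : φterm (suc k) (suc k) (suc k) ≡ 1ℚ - c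
  φterm-diagonal rewrite νℕ-refl (suc k) = begin
    (- N) * (- N) * inv (suc k ℕ.* suc (suc k)) ≡⟨ cong ((- N) * (- N) *_) (inv-* (suc k) (suc (suc k))) ⟩
    (- N) * (- N) * (a * c)                     ≡⟨ regroup N a c ⟩
    (N * a) * ((1ℚ + N) * c - c)                ≡⟨ cong₂ (λ x y → x * (y - c)) (ℕ→ℚ*inv k) (1+ℕ→ℚ*inv (suc k)) ⟩
    1ℚ * (1ℚ - c)                               ≡⟨ ℚP.*-identityˡ (1ℚ - c) ⟩
    1ℚ - c                                      ∎
    where
    open ≡-Reasoning
    regroup : ∀ N a c → (- N) * (- N) * (a * c) ≡ (N * a) * ((1ℚ + N) * c - c)
    regroup = solve-∀ ℚ-ring

  φterm-offDiagonal : ∀ {d} → d < suc k → φterm d (suc k) (suc k) ≡ 0ℚ - c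
  φterm-offDiagonal d<k rewrite νℕ-< d<k | νℕ-refl (suc k) = begin
    1ℚ * (- N) * inv (suc k ℕ.* suc (suc k)) ≡⟨ cong (1ℚ * (- N) *_) (inv-* (suc k) (suc (suc k))) ⟩
    1ℚ * (- N) * (a * c)                     ≡⟨ regroup N a c ⟩
    0ℚ - (N * a) * c                         ≡⟨ cong (λ x → 0ℚ - x * c) (ℕ→ℚ*inv k) ⟩
    0ℚ - 1ℚ * c                              ≡⟨ cong (λ x → 0ℚ - x) (ℚP.*-identityˡ c) ⟩
    0ℚ - c                                   ∎
    where
    open ≡-Reasoning
    regroup : ∀ N a c → 1ℚ * (- N) * (a * c) ≡ 0ℚ - (N * a) * c
    regroup = solve-∀ ℚ-ring

∑< : ℕ → (ℕ → ℚ) → ℚ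
∑< zero    F = 0ℚ
∑< (suc n) F = F 0 + ∑< n (λ j → F (suc j))

∑<-cong : ∀ n {F G : ℕ → ℚ} → (∀ j → F j ≡ G j) → ∑< n F ≡ ∑< n G
∑<-cong zero    F≡G = refl
∑<-cong (suc n) F≡G = cong₂ _+_ (F≡G 0) (∑<-cong n (λ j → F≡G (suc j)))

∑<-suc : ∀ n F → ∑< (suc n) F ≡ ∑< n F + F n
∑<-suc zero    F = ℚP.+-comm (F 0) 0ℚ
∑<-suc (suc n) F = trans (cong (λ x → F 0 + x) (∑<-suc n (λ j → F (suc j))))
                         (sym (ℚP.+-assoc (F 0) (∑< n (λ j → F (suc j))) (F (suc n))))

∑<-zero : ∀ n F → (∀ {j} → j < n → F j ≡ 0ℚ) → ∑< n F ≡ 0ℚ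
∑<-zero zero    F F≡0 = refl
∑<-zero (suc n) F F≡0 = cong₂ _+_ (F≡0 (s≤s z≤n)) (∑<-zero n (λ j → F (suc j)) (λ j<n → F≡0 (s≤s j<n)))

∑<-last : ∀ n F → (∀ {j} → j < n → F j ≡ 0ℚ) → ∑< (suc n) F ≡ F n
∑<-last n F F≡0 = trans (∑<-suc n F) (trans (cong (_+ F n) (∑<-zero n F F≡0)) (ℚP.+-identityˡ (F n)))

∑<-telescope : ∀ {m} F c → ∑< (suc m) F ≡ c - inv (suc m) →
               (∀ {j} → m < j → F j ≡ inv j - inv (suc j)) →
               ∀ {n} → m < n → ∑< n F ≡ c - inv n
∑<-telescope F c base step {suc n} m<1+n with ℕP.m≤n⇒m<n∨m≡n (ℕ.s≤s⁻¹ m<1+n)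
... | inj₂ refl = base
... | inj₁ m<n  = begin
  ∑< (suc n) F                        ≡⟨ ∑<-suc n F ⟩
  ∑< n F + F n                        ≡⟨ cong₂ _+_ (∑<-telescope F c base step m<n) (step m<n) ⟩
  (c - inv n) + (inv n - inv (suc n)) ≡⟨ cancel c (inv n) (inv (suc n)) ⟩
  c - inv (suc n)                     ∎
  where
  open ≡-Reasoning
  cancel : ∀ c a b → (c - a) + (a - b) ≡ c - b
  cancel = solve-∀ ℚ-ring

∑<-φterm-diagonal : ∀ {d b} → d < b → ∑< b (φterm d d) ≡ 1ℚ - inv b
∑<-φterm-diagonal {d} d<b = ∑<-telescope (φterm d d) 1ℚ (initial d) (λ d<j → φterm-above d<j d<j) d<b
  where
  initial : ∀ d → ∑< (suc d) (φterm d d) ≡ 1ℚ - inv (suc d)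
  initial zero    = refl
  initial (suc k) = trans (∑<-last (suc k) (φterm (suc k) (suc k)) (φterm-below (suc k))) (φterm-diagonal k)

∑<-φterm-offDiagonal : ∀ {d e b} → d < e → e < b → ∑< b (φterm d e) ≡ 0ℚ - inv b
∑<-φterm-offDiagonal {d} {suc k} d<e e<b =
  ∑<-telescope (φterm d (suc k)) 0ℚ initial (λ e<j → φterm-above (ℕP.<-trans d<e e<j) e<j) e<b
  where
  initial : ∑< (suc (suc k)) (φterm d (suc k)) ≡ 0ℚ - inv (suc (suc k))
  initial = trans (∑<-last (suc k) (φterm d (suc k)) (λ j<e → trans (φterm-comm d (suc k) _) (φterm-below d j<e)))
                  (φterm-offDiagonal k d<e)

∑<-φterm : ∀ {b} (d c : Fin b) →
           ∑< b (φterm (toℕ d) (toℕ c)) ≡ (if toℕ c ≡ᵇ toℕ d then ℕ→ℚ (b ∸ 1) * inv b else - inv b)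
∑<-φterm {suc b} d c with toℕ c ≡ᵇ toℕ d in eq
... | true rewrite ℕP.≡ᵇ⇒≡ (toℕ c) (toℕ d) (subst T (sym eq) _) =
  trans (∑<-φterm-diagonal (FinP.toℕ<n d)) (1-inv-suc b)
... | false with ℕP.<-cmp (toℕ d) (toℕ c)
...   | tri< d<c _ _ = trans (∑<-φterm-offDiagonal d<c (FinP.toℕ<n c)) (ℚP.+-identityˡ (- inv (suc b)))
...   | tri≈ _ d≡c _ = ⊥-elim (subst T eq (ℕP.≡⇒≡ᵇ _ _ (sym d≡c)))
...   | tri> _ _ c<d = trans (∑<-cong (suc b) (φterm-comm (toℕ d) (toℕ c)))
                             (trans (∑<-φterm-offDiagonal c<d (FinP.toℕ<n d)) (ℚP.+-identityˡ (- inv (suc b))))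

∑-cong : ∀ n {f g : Fin n → ℚ} → (∀ j → f j ≡ g j) → ∑ n f ≡ ∑ n g
∑-cong zero    f≡g = refl
∑-cong (suc n) f≡g = cong₂ _+_ (f≡g Fin.zero) (∑-cong n (λ j → f≡g (Fin.suc j)))

∑-toℕ : ∀ n (F : ℕ → ℚ) → ∑ n (λ j → F (toℕ j)) ≡ ∑< n F
∑-toℕ zero    F = refl
∑-toℕ (suc n) F = cong (λ x → F 0 + x) (∑-toℕ n (λ j → F (suc j)))

-- φ starts its sum at max{1, d}; starting at 1 only adds zero terms, since ν(d, j) = 0 for j < d.
φ-summand : ∀ d e j → (if (1 ≤ᵇ j) ∧ (d ≤ᵇ j) then νℕ d j * νℕ e j * inv (j ℕ.* suc j) else 0ℚ) ≡ φterm d e j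
φ-summand d e zero    = refl
φ-summand d e (suc j) with d ≤ᵇ suc j in eq
... | true  = refl
... | false = sym (φterm-below {d} e {suc j} (ℕP.≰⇒> (λ d≤j → subst T eq (ℕP.≤⇒≤ᵇ d≤j))))

φ-sum : ∀ {b} (d c : Fin b) →
        ∑ b (λ j → if (1 ≤ᵇ toℕ j) ∧ (toℕ d ≤ᵇ toℕ j)
                   then ν b (dig d) (dig j) * ν b (dig c) (dig j) * inv (toℕ j ℕ.* suc (toℕ j)) else 0ℚ)
        ≡ (if toℕ c ≡ᵇ toℕ d then ℕ→ℚ (b ∸ 1) * inv b else - inv b)
φ-sum {b} d c =
  trans (∑-cong b (λ j → φ-summand (toℕ d) (toℕ c) (toℕ j)))
        (trans (∑-toℕ b (φterm (toℕ d) (toℕ c))) (∑<-φterm d c))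

∈-tabulate : ∀ {n} {f : Fin n → Bool} {i} → i ∈ tabulate f → f i ≡ true
∈-tabulate {f = f} {i} i∈ = trans (sym (lookup∘tabulate f i)) ([]=⇒lookup i∈)

module _ {A : Set} where

  sumList-cong : ∀ {f g : A → ℚ} xs → (∀ x → f x ≡ g x) → sumList f xs ≡ sumList g xs
  sumList-cong []       f≡g = refl
  sumList-cong (x ∷ xs) f≡g = cong₂ _+_ (f≡g x) (sumList-cong xs f≡g)

  sumList-++ : ∀ (f : A → ℚ) xs ys → sumList f (xs ++ ys) ≡ sumList f xs + sumList f ys
  sumList-++ f []       ys = sym (ℚP.+-identityˡ (sumList f ys))
  sumList-++ f (x ∷ xs) ys = trans (cong (λ s → f x + s) (sumList-++ f xs ys))
                                   (sym (ℚP.+-assoc (f x) (sumList f xs) (sumList f ys)))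

  sumList-*ˡ : ∀ c (f : A → ℚ) xs → sumList (λ x → c * f x) xs ≡ c * sumList f xs
  sumList-*ˡ c f []       = sym (ℚP.*-zeroʳ c)
  sumList-*ˡ c f (x ∷ xs) = trans (cong (λ s → c * f x + s) (sumList-*ˡ c f xs))
                                  (sym (ℚP.*-distribˡ-+ c (f x) (sumList f xs)))

  sumList-*ʳ : ∀ c (f : A → ℚ) xs → sumList (λ x → f x * c) xs ≡ sumList f xs * c
  sumList-*ʳ c f []       = sym (ℚP.*-zeroˡ c)
  sumList-*ʳ c f (x ∷ xs) = trans (cong (λ s → f x * c + s) (sumList-*ʳ c f xs))
                                  (sym (ℚP.*-distribʳ-+ c (f x) (sumList f xs)))

  sumList-0 : ∀ xs → sumList (λ (_ : A) → 0ℚ) xs ≡ 0ℚ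
  sumList-0 []       = refl
  sumList-0 (x ∷ xs) = trans (ℚP.+-identityˡ _) (sumList-0 xs)

module _ {A B : Set} where

  sumList-map : ∀ (f : B → ℚ) (g : A → B) xs → sumList f (List.map g xs) ≡ sumList (λ x → f (g x)) xs
  sumList-map f g []       = refl
  sumList-map f g (x ∷ xs) = cong (λ s → f (g x) + s) (sumList-map f g xs)

  sumList-concatMap : ∀ (f : B → ℚ) (g : A → List B) xs →
                      sumList f (List.concatMap g xs) ≡ sumList (λ x → sumList f (g x)) xs
  sumList-concatMap f g []       = refl
  sumList-concatMap f g (x ∷ xs) = trans (sumList-++ f (g x) (List.concatMap g xs))
                                         (cong (λ s → sumList f (g x) + s) (sumList-concatMap f g xs))

sumList-filter : ∀ {A : Set} n (f : Fin n → A) (p : A → Bool) (h : A → ℚ) →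
                 sumList h (List.filterᵇ p (List.tabulate f)) ≡ ∑ n (λ j → if p (f j) then h (f j) else 0ℚ)
sumList-filter zero    f p h = refl
sumList-filter (suc n) f p h with p (f Fin.zero)
... | true  = cong (λ s → h (f Fin.zero) + s) (sumList-filter n (λ j → f (Fin.suc j)) p h)
... | false = trans (sumList-filter n (λ j → f (Fin.suc j)) p h) (sym (ℚP.+-identityˡ _))

∏-cong : ∀ n {f g : Fin n → ℚ} → (∀ i → f i ≡ g i) → ∏ n f ≡ ∏ n g
∏-cong zero    f≡g = refl
∏-cong (suc n) f≡g = cong₂ _*_ (f≡g Fin.zero) (∏-cong n (λ i → f≡g (Fin.suc i)))

∏-* : ∀ n (f g : Fin n → ℚ) → ∏ n (λ i → f i * g i) ≡ ∏ n f * ∏ n g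
∏-* zero    f g = refl
∏-* (suc n) f g = trans (cong (f Fin.zero * g Fin.zero *_) (∏-* n (λ i → f (Fin.suc i)) (λ i → g (Fin.suc i))))
                        (interchange (f Fin.zero) (g Fin.zero) _ _)
  where
  interchange : ∀ a b c d → a * b * (c * d) ≡ a * c * (b * d)
  interchange = solve-∀ ℚ-ring

sumList-allWords : ∀ ℓ (B : Fin ℓ → ℕ) (L : (i : Fin ℓ) → List (Δ (B i))) (t : (i : Fin ℓ) → Δ (B i) → ℚ) →
                   sumList (λ w → ∏ ℓ (λ i → t i (w i))) (allWords ℓ B L) ≡ ∏ ℓ (λ i → sumList (t i) (L i))
sumList-allWords zero    B L t = refl
sumList-allWords (suc ℓ) B L t = begin
  sumList (λ w → ∏ (suc ℓ) (λ i → t i (w i))) (allWords (suc ℓ) B L)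
    ≡⟨ sumList-concatMap _ _ (L Fin.zero) ⟩
  sumList (λ x → sumList (λ w → ∏ (suc ℓ) (λ i → t i (w i))) (List.map _ W)) (L Fin.zero)
    ≡⟨ sumList-cong (L Fin.zero) (λ x → trans (sumList-map _ _ W) (sumList-*ˡ (t Fin.zero x) _ W)) ⟩
  sumList (λ x → t Fin.zero x * sumList (λ w → ∏ ℓ (λ i → t′ i (w i))) W) (L Fin.zero)
    ≡⟨ sumList-*ʳ _ (t Fin.zero) (L Fin.zero) ⟩
  sumList (t Fin.zero) (L Fin.zero) * sumList (λ w → ∏ ℓ (λ i → t′ i (w i))) W
    ≡⟨ cong (sumList (t Fin.zero) (L Fin.zero) *_) (sumList-allWords ℓ _ _ t′) ⟩
  ∏ (suc ℓ) (λ i → sumList (t i) (L i)) ∎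
  where
  open ≡-Reasoning
  W = allWords ℓ (λ i → B (Fin.suc i)) (λ i → L (Fin.suc i))
  t′ = λ i → t (Fin.suc i)

≡-dec-∷ : ∀ {n} (x y : Bool) (xs ys : Vec Bool n) →
          ⌊ ≡-dec _≟B_ (x ∷ xs) (y ∷ ys) ⌋ ≡ ⌊ x ≟B y ⌋ ∧ ⌊ ≡-dec _≟B_ xs ys ⌋
≡-dec-∷ x y xs ys with ≡-dec _≟B_ xs ys | x ≟B y
... | yes _ | yes _ = refl
... | yes _ | no  _ = refl
... | no  _ | yes _ = refl
... | no  _ | no  _ = refl

if-∧-* : ∀ (a b : Bool) (x y : ℚ) → (if a ∧ b then x * y else 0ℚ) ≡ (if a then x else 0ℚ) * (if b then y else 0ℚ)
if-∧-* true  true  x y = refl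
if-∧-* true  false x y = sym (ℚP.*-zeroʳ x)
if-∧-* false b     x y = sym (ℚP.*-zeroˡ (if b then y else 0ℚ))

coordDenom : ∀ {b} → Δ b → ℕ
coordDenom y = if not (isGap y) then digVal y ℕ.+ digVal y ℕ.* digVal y else 1

coordTerm : (b : ℕ) → Δ b → Fin b → Bool → Δ b → ℚ
coordTerm b x c g y = if ⌊ isGap y ≟B g ⌋ then ν b x y * ν b (dig c) y * inv (coordDenom y) else 0ℚ

summand-∏ : ∀ {ℓ} (B : Fin ℓ → ℕ) (u : ΣB B) (v : ΔB B) (G : Subset ℓ) (w : ΔB B) →
            (if ⌊ ≡-dec _≟B_ (Gset w) G ⌋ then νB B v w * νB B (emb u) w * inv (denom w) else 0ℚ)
            ≡ ∏ ℓ (λ i → coordTerm (B i) (v i) (u i) (lookup G i) (w i))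
summand-∏ {zero}  B u v []      w = refl
summand-∏ {suc ℓ} B u v (g ∷ G) w = begin
  (if ⌊ ≡-dec _≟B_ (Gset w) (g ∷ G) ⌋ then (x₀ * x′) * (y₀ * y′) * inv (d₀ ℕ.* d′) else 0ℚ)
    ≡⟨ cong (λ t → if t then (x₀ * x′) * (y₀ * y′) * inv (d₀ ℕ.* d′) else 0ℚ) (≡-dec-∷ _ g _ G) ⟩
  (if a ∧ b then (x₀ * x′) * (y₀ * y′) * inv (d₀ ℕ.* d′) else 0ℚ)
    ≡⟨ cong (λ z → if a ∧ b then z else 0ℚ) (trans (cong ((x₀ * x′) * (y₀ * y′) *_) (inv-* d₀ d′))
                                                   (regroup x₀ x′ y₀ y′ (inv d₀) (inv d′))) ⟩
  (if a ∧ b then (x₀ * y₀ * inv d₀) * (x′ * y′ * inv d′) else 0ℚ)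
    ≡⟨ if-∧-* a b _ _ ⟩
  coordTerm (B Fin.zero) (v Fin.zero) (u Fin.zero) g (w Fin.zero) * (if b then x′ * y′ * inv d′ else 0ℚ)
    ≡⟨ cong (coordTerm (B Fin.zero) (v Fin.zero) (u Fin.zero) g (w Fin.zero) *_)
            (summand-∏ (λ i → B (Fin.suc i)) (λ i → u (Fin.suc i)) (λ i → v (Fin.suc i)) G w′) ⟩
  ∏ (suc ℓ) (λ i → coordTerm (B i) (v i) (u i) (lookup (g ∷ G) i) (w i)) ∎
  where
  open ≡-Reasoning
  B′ = λ i → B (Fin.suc i)
  w′ : ΔB B′
  w′ i = w (Fin.suc i)
  a = ⌊ isGap (w Fin.zero) ≟B g ⌋
  b = ⌊ ≡-dec _≟B_ (Gset w′) G ⌋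
  x₀ = ν (B Fin.zero) (v Fin.zero) (w Fin.zero)
  y₀ = ν (B Fin.zero) (dig (u Fin.zero)) (w Fin.zero)
  d₀ = coordDenom (w Fin.zero)
  x′ = νB B′ (λ i → v (Fin.suc i)) w′
  y′ = νB B′ (λ i → dig (u (Fin.suc i))) w′
  d′ = denom w′
  regroup : ∀ x₀ x′ y₀ y′ e₀ e′ → (x₀ * x′) * (y₀ * y′) * (e₀ * e′) ≡ (x₀ * y₀ * e₀) * (x′ * y′ * e′)
  regroup = solve-∀ ℚ-ring

coordSum-gap : ∀ b (x : Δ b) (c : Fin b) → sumList (coordTerm b x c true) (Γlist b) ≡ ν b x gap
coordSum-gap b x c = begin
  ν b x gap * 1ℚ * 1ℚ + sumList (coordTerm b x c true) (List.map dig ds)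
    ≡⟨ cong₂ _+_ (trans (ℚP.*-identityʳ (ν b x gap * 1ℚ)) (ℚP.*-identityʳ (ν b x gap)))
                 (trans (sumList-map (coordTerm b x c true) dig ds) (sumList-0 ds)) ⟩
  ν b x gap + 0ℚ
    ≡⟨ ℚP.+-identityʳ (ν b x gap) ⟩
  ν b x gap ∎
  where
  open ≡-Reasoning
  ds = List.filterᵇ (λ j → 1 ≤ᵇ toℕ j) (List.allFin b)

coordSum-dig : ∀ b (d c : Fin b) → sumList (coordTerm b (dig d) c false) (Γlist b)
               ≡ (if toℕ c ≡ᵇ toℕ d then ℕ→ℚ (b ∸ 1) * inv b else - inv b)
coordSum-dig b d c = begin
  0ℚ + sumList (coordTerm b (dig d) c false) (List.map dig ds)
    ≡⟨ trans (ℚP.+-identityˡ _) (sumList-map _ dig ds) ⟩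
  sumList (λ j → coordTerm b (dig d) c false (dig j)) ds
    ≡⟨ sumList-filter b (λ j → j) (λ j → 1 ≤ᵇ toℕ j) _ ⟩
  ∑ b (λ j → if 1 ≤ᵇ toℕ j then coordTerm b (dig d) c false (dig j) else 0ℚ)
    ≡⟨ ∑-cong b (λ j → summand (toℕ j)) ⟩
  ∑ b (λ j → φterm (toℕ d) (toℕ c) (toℕ j))
    ≡⟨ ∑-toℕ b (φterm (toℕ d) (toℕ c)) ⟩
  ∑< b (φterm (toℕ d) (toℕ c))
    ≡⟨ ∑<-φterm d c ⟩
  (if toℕ c ≡ᵇ toℕ d then ℕ→ℚ (b ∸ 1) * inv b else - inv b) ∎
  where
  open ≡-Reasoning
  ds = List.filterᵇ (λ j → 1 ≤ᵇ toℕ j) (List.allFin b)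
  summand : ∀ j → (if 1 ≤ᵇ j then νℕ (toℕ d) j * νℕ (toℕ c) j * inv (j ℕ.+ j ℕ.* j) else 0ℚ) ≡ φterm (toℕ d) (toℕ c) j
  summand j = cong (λ n → if 1 ≤ᵇ j then νℕ (toℕ d) j * νℕ (toℕ c) j * inv n else 0ℚ) (sym (ℕP.*-suc j j))

negOnePow-+ : ∀ m n → negOnePow (m ℕ.+ n) ≡ negOnePow m * negOnePow n
negOnePow-+ zero    n = sym (ℚP.*-identityˡ (negOnePow n))
negOnePow-+ (suc m) n = trans (cong -_ (negOnePow-+ m n)) (ℚP.neg-distribˡ-* (negOnePow m) (negOnePow n))

negOnePow-∣∣ : ∀ {n} (S : Subset n) → negOnePow ∣ S ∣ ≡ ∏∈ S (λ _ → - 1ℚ)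
negOnePow-∣∣ []          = refl
negOnePow-∣∣ (true ∷ S)  = trans (cong -_ (trans (negOnePow-∣∣ S) (sym (ℚP.*-identityˡ (∏∈ S (λ _ → - 1ℚ)))))) (ℚP.neg-distribˡ-* 1ℚ (∏∈ S (λ _ → - 1ℚ)))
negOnePow-∣∣ (false ∷ S) = trans (negOnePow-∣∣ S) (sym (ℚP.*-identityˡ _))

ℕ→ℚ-∏ℕ∈ : ∀ {n} (S : Subset n) (f : Fin n → ℕ) → ℕ→ℚ (∏ℕ∈ S f) ≡ ∏∈ S (λ i → ℕ→ℚ (f i))
ℕ→ℚ-∏ℕ∈ []          f = refl
ℕ→ℚ-∏ℕ∈ (true ∷ S)  f = trans (ℕ→ℚ-* (f Fin.zero) (∏ℕ∈ S (λ i → f (Fin.suc i)))) (cong (ℕ→ℚ (f Fin.zero) *_) (ℕ→ℚ-∏ℕ∈ S (λ i → f (Fin.suc i))))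
ℕ→ℚ-∏ℕ∈ (false ∷ S) f = trans (ℕ→ℚ-* 1 (∏ℕ∈ S (λ i → f (Fin.suc i)))) (cong (1ℚ *_) (ℕ→ℚ-∏ℕ∈ S (λ i → f (Fin.suc i))))

inv-∏ℕ∈ : ∀ {n} (S : Subset n) (f : Fin n → ℕ) → inv (∏ℕ∈ S f) ≡ ∏∈ S (λ i → inv (f i))
inv-∏ℕ∈ []          f = refl
inv-∏ℕ∈ (true ∷ S)  f = trans (inv-* (f Fin.zero) (∏ℕ∈ S (λ i → f (Fin.suc i)))) (cong (inv (f Fin.zero) *_) (inv-∏ℕ∈ S (λ i → f (Fin.suc i))))
inv-∏ℕ∈ (false ∷ S) f = trans (inv-* 1 (∏ℕ∈ S (λ i → f (Fin.suc i)))) (cong (1ℚ *_) (inv-∏ℕ∈ S (λ i → f (Fin.suc i))))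

sign : Bool → ℚ
sign s = if s then - 1ℚ else 1ℚ

rhsFactor : ℕ → (a c p d : Bool) → ℚ
rhsFactor b a c p d = sign a * sign c * (if c then ℕ→ℚ b else 1ℚ) * (if p then ℕ→ℚ (b ∸ 1) else 1ℚ) * (if d then inv b else 1ℚ)

rhs-∏ : ∀ {ℓ} (B : Fin ℓ → ℕ) (A C P D : Subset ℓ) →
        negOnePow (∣ A ∣ ℕ.+ ∣ C ∣) * ℕ→ℚ (∏ℕ∈ C B) * ℕ→ℚ (∏ℕ∈ P (λ i → B i ∸ 1)) * inv (∏ℕ∈ D B)
        ≡ ∏ ℓ (λ i → rhsFactor (B i) (lookup A i) (lookup C i) (lookup P i) (lookup D i))
rhs-∏ {ℓ} B A C P D = begin
  negOnePow (∣ A ∣ ℕ.+ ∣ C ∣) * ℕ→ℚ (∏ℕ∈ C B) * ℕ→ℚ (∏ℕ∈ P (λ i → B i ∸ 1)) * inv (∏ℕ∈ D B)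
    ≡⟨ cong₂ _*_ (cong₂ _*_ (cong₂ _*_ (trans (negOnePow-+ ∣ A ∣ ∣ C ∣) (cong₂ _*_ (negOnePow-∣∣ A) (negOnePow-∣∣ C)))
                                       (ℕ→ℚ-∏ℕ∈ C B))
                            (ℕ→ℚ-∏ℕ∈ P (λ i → B i ∸ 1)))
                 (inv-∏ℕ∈ D B) ⟩
  ∏ ℓ a * ∏ ℓ c * ∏ ℓ c′ * ∏ ℓ p * ∏ ℓ d
    ≡⟨ cong (λ z → z * ∏ ℓ c′ * ∏ ℓ p * ∏ ℓ d) (∏-* ℓ a c) ⟨
  ∏ ℓ (λ i → a i * c i) * ∏ ℓ c′ * ∏ ℓ p * ∏ ℓ d
    ≡⟨ cong (λ z → z * ∏ ℓ p * ∏ ℓ d) (∏-* ℓ (λ i → a i * c i) c′) ⟨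
  ∏ ℓ (λ i → a i * c i * c′ i) * ∏ ℓ p * ∏ ℓ d
    ≡⟨ cong (_* ∏ ℓ d) (∏-* ℓ (λ i → a i * c i * c′ i) p) ⟨
  ∏ ℓ (λ i → a i * c i * c′ i * p i) * ∏ ℓ d
    ≡⟨ ∏-* ℓ (λ i → a i * c i * c′ i * p i) d ⟨
  ∏ ℓ (λ i → rhsFactor (B i) (lookup A i) (lookup C i) (lookup P i) (lookup D i)) ∎
  where
  open ≡-Reasoning
  a = λ i → sign (lookup A i)
  c = λ i → sign (lookup C i)
  c′ = λ i → if lookup C i then ℕ→ℚ (B i) else 1ℚ
  p = λ i → if lookup P i then ℕ→ℚ (B i ∸ 1) else 1ℚ
  d = λ i → if lookup D i then inv (B i) else 1ℚ

-- Stated with not (lookup q i) first, so that it computes as soon as membership in q is known.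
lookup-─ : ∀ {n} (p q : Subset n) i → lookup (p ─ q) i ≡ not (lookup q i) ∧ lookup p i
lookup-─ (x ∷ p) (true  ∷ q) Fin.zero    = refl
lookup-─ (x ∷ p) (false ∷ q) Fin.zero    = refl
lookup-─ (x ∷ p) (_     ∷ q) (Fin.suc i) = lookup-─ p q i

rhsFactor-cong : ∀ {b a a′ c c′ p p′ d d′} → a ≡ a′ → c ≡ c′ → p ≡ p′ → d ≡ d′ →
                 rhsFactor b a c p d ≡ rhsFactor b a′ c′ p′ d′
rhsFactor-cong refl refl refl refl = refl

coordSum : ∀ b (x : Δ b) (c : Fin b) g → (isGap x ≡ true → g ≡ true) →
           sumList (coordTerm b x c g) (Γlist b)
           ≡ rhsFactor b (not g ∧ not (isGap x) ∧ not (sameDig c x)) (isGap x) (not g ∧ not (isGap x) ∧ sameDig c x) (not g)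
coordSum b gap     c true  _         = trans (coordSum-gap b gap c) (gapFactor (ℕ→ℚ b))
  where
  gapFactor : ∀ N → - N ≡ 1ℚ * (- 1ℚ) * N * 1ℚ * 1ℚ
  gapFactor = solve-∀ ℚ-ring
coordSum b gap     c false gap⇒true with () ← gap⇒true refl
coordSum b (dig d) c true  _         = coordSum-gap b (dig d) c
coordSum b (dig d) c false _ with toℕ c ≡ᵇ toℕ d | coordSum-dig b d c
... | true  | sum≡ = trans sum≡ (sameFactor (ℕ→ℚ (b ∸ 1)) (inv b))
  where
  sameFactor : ∀ x y → x * y ≡ 1ℚ * 1ℚ * 1ℚ * x * y
  sameFactor = solve-∀ ℚ-ring
... | false | sum≡ = trans sum≡ (differentFactor (inv b))
  where
  differentFactor : ∀ y → - y ≡ (- 1ℚ) * 1ℚ * 1ℚ * 1ℚ * y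
  differentFactor = solve-∀ ℚ-ring

coordSum≡rhsFactor : ∀ {ℓ} (B : Fin ℓ → ℕ) (u : ΣB B) (v : ΔB B) (G : Subset ℓ) → Gset v ⊆ G → ∀ i →
                     sumList (coordTerm (B i) (v i) (u i) (lookup G i)) (Γlist (B i))
                     ≡ rhsFactor (B i) (lookup (Qset u v ─ G) i) (lookup (Gset v) i) (lookup (Pset u v ─ G) i) (lookup (∁ G) i)
coordSum≡rhsFactor B u v G Gv⊆G i =
  trans (coordSum (B i) (v i) (u i) (lookup G i) gap⇒∈G)
        (sym (rhsFactor-cong {B i} (trans (lookup-─ (Qset u v) G i) (cong (not (lookup G i) ∧_) (lookup∘tabulate _ i)))
                             (lookup∘tabulate _ i)
                             (trans (lookup-─ (Pset u v) G i) (cong (not (lookup G i) ∧_) (lookup∘tabulate _ i)))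
                             (lookup-map i not G)))
  where
  gap⇒∈G : isGap (v i) ≡ true → lookup G i ≡ true
  gap⇒∈G isGap = []=⇒lookup (Gv⊆G (lookup⇒[]= i (Gset v) (trans (lookup∘tabulate _ i) isGap)))

φ-closedForm : ∀ {ℓ} (B : Fin ℓ → ℕ) (u : ΣB B) (v : ΔB B) (i : Fin ℓ) →
               (i ∈ Pset u v → φ B u v i ≡ ℕ→ℚ (B i ∸ 1) * inv (B i)) ×
               (i ∈ Qset u v → φ B u v i ≡ - inv (B i))
φ-closedForm B u v i = onP , onQ
  where
  value : Bool → ℚ
  value s = if s then ℕ→ℚ (B i ∸ 1) * inv (B i) else - inv (B i)
  onP : i ∈ Pset u v → φ B u v i ≡ value true
  onP i∈P with v i | ∈-tabulate i∈P
  ... | dig d | same = trans (φ-sum d (u i)) (cong value same)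
  onQ : i ∈ Qset u v → φ B u v i ≡ value false
  onQ i∈Q with v i | ∈-tabulate i∈Q
  ... | dig d | differ = trans (φ-sum d (u i)) (cong value (not-injective differ))

sumΓ-closedForm : ∀ {ℓ} (B : Fin ℓ → ℕ) (u : ΣB B) (v : ΔB B) (G : Subset ℓ) → Gset v ⊆ G →
                  sumΓ B G (λ w → νB B v w * νB B (emb u) w * inv (denom w))
                  ≡ negOnePow (∣ Qset u v ─ G ∣ ℕ.+ ∣ Gset v ∣) * ℕ→ℚ (∏ℕ∈ (Gset v) B)
                    * ℕ→ℚ (∏ℕ∈ (Pset u v ─ G) (λ i → B i ∸ 1)) * inv (∏ℕ∈ (∁ G) B)
sumΓ-closedForm {ℓ} B u v G Gv⊆G = begin
  sumΓ B G (λ w → νB B v w * νB B (emb u) w * inv (denom w))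
    ≡⟨ sumList-cong (ΓB B) (summand-∏ B u v G) ⟩
  sumList (λ w → ∏ ℓ (λ i → coordTerm (B i) (v i) (u i) (lookup G i) (w i))) (ΓB B)
    ≡⟨ sumList-allWords ℓ B (λ i → Γlist (B i)) (λ i → coordTerm (B i) (v i) (u i) (lookup G i)) ⟩
  ∏ ℓ (λ i → sumList (coordTerm (B i) (v i) (u i) (lookup G i)) (Γlist (B i)))
    ≡⟨ ∏-cong ℓ (coordSum≡rhsFactor B u v G Gv⊆G) ⟩
  ∏ ℓ (λ i → rhsFactor (B i) (lookup (Qset u v ─ G) i) (lookup (Gset v) i) (lookup (Pset u v ─ G) i) (lookup (∁ G) i))
    ≡⟨ rhs-∏ B (Qset u v ─ G) (Gset v) (Pset u v ─ G) (∁ G) ⟨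
  negOnePow (∣ Qset u v ─ G ∣ ℕ.+ ∣ Gset v ∣) * ℕ→ℚ (∏ℕ∈ (Gset v) B)
    * ℕ→ℚ (∏ℕ∈ (Pset u v ─ G) (λ i → B i ∸ 1)) * inv (∏ℕ∈ (∁ G) B) ∎
  where open ≡-Reasoning

proposition3 : (ℓ : ℕ) → 1 ≤ ℓ → (B : Fin ℓ → ℕ) → ((i : Fin ℓ) → 2 ≤ B i) →
    (u : ΣB B) → (v : ΔB B) →
    ((i : Fin ℓ) →
       (i ∈ Pset u v → φ B u v i ≡ ℕ→ℚ (B i ∸ 1) * inv (B i)) ×
       (i ∈ Qset u v → φ B u v i ≡ - inv (B i)))
    ×
    ((G : Subset ℓ) → Gset v ⊆ G →
       sumΓ B G (λ v′ → νB B v v′ * νB B (emb u) v′ * inv (denom v′))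
       ≡ negOnePow (∣ Qset u v ─ G ∣ Data.Nat.+ ∣ Gset v ∣)
         * ℕ→ℚ (∏ℕ∈ (Gset v) B)
         * ℕ→ℚ (∏ℕ∈ (Pset u v ─ G) (λ i → B i ∸ 1))
         * inv (∏ℕ∈ (∁ G) B))
proposition3 ℓ _ B _ u v = φ-closedForm B u v , sumΓ-closedForm B u v
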